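{- Let $\Sigma$ and $\Pi$ be disjoint alphabets, let $t \in (\Sigma\cup\Pi)^n$, and let $\mathrm{PPH}(t)$ be the parameterized position heap of $t$. Let $1 \le i \le j \le n$. If the string $\mathrm{prev}(t[i:j])$ is represented in $\mathrm{PPH}(t)$, then for every $i', j'$ with $i \le i' \le j' \le j$ the string $\mathrm{prev}(t[i':j'])$ is also represented in $\mathrm{PPH}(t)$.
   Context: $\Sigma$ (constant symbols) and $\Pi$ (parameter symbols) are disjoint sets; a p-string is a string over $\Sigma\cup\Pi$. For a p-string $w$, $w[i]$ is its $i$-th symbol, $w[i:j]$ the substring from position $i$ to $j$ (empty if $i>j$), $w[i:] = w[i:|w|]$. The prev-encoding $\mathrm{prev}(w)$ is the string $x$ of length $|w|$ over $\Sigma \cup \mathbb{N}$ with $x[i]=w[i]$ if $w[i]\in\Sigma$; $x[i]=0$ if $w[i]\in\Pi$ and $w[i]\ne w[j]$ for all $j<i$; and otherwise $x[i] = i - \max\{j<i : w[j]=w[i]\}$. A sequence hash tree $\mathrm{SHT}(W)$ of an ordered list of strings $W=(w_1,\dots,w_n)$ is the trie (edges labeled by single symbols; each node identified with the concatenation of labels on the path from the root) defined recursively: $\mathrm{SHT}(W_0)$ is the single root node $\varepsilon$; $\mathrm{SHT}(W_i)$ is obtained from $\mathrm{SHT}(W_{i-1})$ by adding the node $p_i$ and the edge from $w_i[1:|p_i|-1]$ to $p_i$ labeled $w_i[|p_i|]$, where $p_i$ is the shortest prefix of $w_i$ not already a node; if no such $p_i$ exists the tree is unchanged. The parameterized position heap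 of $t \in (\Sigma\cup\Pi)^n$ is $\mathrm{PPH}(t)=\mathrm{SHT}(\mathrm{prev}(t[1:]),\mathrm{prev}(t[2:]),\dots,\mathrm{prev}(t[n:]))$. A string $x$ is represented in $\mathrm{PPH}(t)$ if there is a node whose root-to-node path label equals $x$. -}

module Defs where

open import Data.Nat using (ℕ; zero; suc; _∸_; _+_)
open import Data.List using (List; []; _∷_; _++_; [_]; take; drop; length; map; foldl; upTo)
open import Data.Sum using (_⊎_; inj₁; inj₂)
import Data.Sum.Properties as SumP
import Data.List.Properties as ListP
import Data.Nat.Properties as NatP
open import Relation.Binary.Definitions using (DecidableEquality)
open import Relation.Binary.PropositionalEquality using (_≡_)
open import Relation.Nullary using (yes; no)
open import Data.List.Membership.Propositional using (_∈_)
import Data.List.Membership.DecPropositional as DecMem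

-- p-strings over constant symbols S (Σ) and parameter symbols P (Π);
-- disjointness of Σ and Π is built in by using the disjoint sum S ⊎ P.
PString : Set → Set → Set
PString S P = List (S ⊎ P)

-- 1-indexed substring w[i:j] (empty if i > j) and suffix w[i:]
substr : {A : Set} → List A → ℕ → ℕ → List A
substr w i j = take (suc j ∸ i) (drop (i ∸ 1) w)

suffix : {A : Set} → List A → ℕ → List A
suffix w i = drop (i ∸ 1) w

-- distance back to the most recent earlier occurrence of p, given the
-- previously seen symbols in reverse order; 0 if no earlier occurrence
backDist : {S P : Set} → DecidableEquality P → P → List (S ⊎ P) → ℕ
backDist _≟_ p [] = 0
backDist _≟_ p (inj₁ _ ∷ rest) with backDist _≟_ p rest
... | zero = zero
... | suc d = suc (suc d)
backDist _≟_ p (inj₂ q ∷ rest) with q ≟ p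
... | yes _ = 1
... | no _ with backDist _≟_ p rest
...   | zero = zero
...   | suc d = suc (suc d)

-- prev-encoding; the first argument is the reversed prefix already read
prevAux : {S P : Set} → DecidableEquality P → List (S ⊎ P) → List (S ⊎ P) → List (S ⊎ ℕ)
prevAux _≟_ seen [] = []
prevAux _≟_ seen (inj₁ c ∷ w) = inj₁ c ∷ prevAux _≟_ (inj₁ c ∷ seen) w
prevAux _≟_ seen (inj₂ p ∷ w) = inj₂ (backDist _≟_ p seen) ∷ prevAux _≟_ (inj₂ p ∷ seen) w

prev : {S P : Set} → DecidableEquality P → List (S ⊎ P) → List (S ⊎ ℕ)
prev _≟_ w = prevAux _≟_ [] w

-- A trie (edges labelled by single symbols, nodes identified with their
-- path labels) is represented by its set of nodes (a prefix-closed list).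
Trie : Set → Set
Trie X = List (List X)

-- add the shortest prefix of w that is not yet a node (if any).
-- pre is the current prefix of the input already known to be a node.
shtInsertAux : {X : Set} → DecidableEquality X → Trie X → List X → List X → Trie X
shtInsertAux _≟_ nodes pre [] = nodes
shtInsertAux _≟_ nodes pre (a ∷ rest) with DecMem._∈?_ (ListP.≡-dec _≟_) (pre ++ [ a ]) nodes
... | yes _ = shtInsertAux _≟_ nodes (pre ++ [ a ]) rest
... | no _ = (pre ++ [ a ]) ∷ nodes

shtInsert : {X : Set} → DecidableEquality X → Trie X → List X → Trie X
shtInsert _≟_ nodes w = shtInsertAux _≟_ nodes [] w

SHT : {X : Set} → DecidableEquality X → List (List X) → Trie X
SHT _≟_ W = foldl (shtInsert _≟_) ([] ∷ []) W

PPH : {S P : Set} → DecidableEquality S → DecidableEquality P → PString S P → Trie (S ⊎ ℕ)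
PPH _≟S_ _≟P_ t =
  SHT (SumP.≡-dec _≟S_ NatP._≟_)
      (map (λ k → prev _≟P_ (suffix t (suc k))) (upTo (length t)))

RepresentedIn : {X : Set} → List X → Trie X → Set
RepresentedIn x T = x ∈ T

module Submission where

-- Two closure
-- properties of its node set give the theorem at once:
--   (a) it is prefix-closed, and
--   (b) it is closed under the map tailEnc with prev(w[2:]) = tailEnc(prev(w)):
--       drop the first symbol and turn back-references to it into 0.
-- Then prev(t[i':j']) is reached from prev(t[i:j]) by taking a prefix (prev
-- commutes with taking prefixes) and applying tailEnc (i' - i) times.

open import Defs
open import Data.Nat using (ℕ; zero; suc; _+_; _∸_; _⊓_; _≡ᵇ_; _≤_)
open import Data.Nat.Properties using (_≟_; m≤n⇒∃[o]m+o≡n; m+n∸m≡n; +-assoc; +-comm; +-suc; ≤-refl; ∸-monoˡ-≤; ≤-trans; n≤1+n; m≤n⇒m⊓n≡m)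
open import Data.Bool using (Bool; true; false; if_then_else_)
open import Data.List using (List; []; _∷_; _++_; [_]; length; take; drop; foldl; applyUpTo)
open import Data.List.Properties using (≡-dec; ++-assoc; ++-identityʳ; ++-conicalʳ; ∷-injectiveˡ; ∷-injectiveʳ; take-take; take-drop; drop-drop; drop-all; map-upTo; take++drop≡id)
open import Data.List.Relation.Unary.Any using (here; there)
open import Data.List.Membership.Propositional using (_∈_)
import Data.List.Membership.DecPropositional as DecMembership
open import Data.Sum using (_⊎_; inj₁; inj₂; map₂)
import Data.Sum.Properties as Sum
open import Data.Product using (_×_; _,_; proj₁; proj₂; ∃-syntax; ∃₂)
open import Data.Empty using (⊥-elim)
open import Relation.Nullary using (Dec; yes; no; does)
open import Relation.Binary.Definitions using (DecidableEquality)
open import Relation.Binary.PropositionalEquality using (_≡_; refl; sym; trans; cong; cong₂; subst; module ≡-Reasoning)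

module TrieInsertion {X : Set} (_≟X_ : DecidableEquality X) where

  insertFrom : Trie X → List X → List X → Trie X
  insertFrom = shtInsertAux _≟X_

  PrefixClosed : Trie X → Set
  PrefixClosed T = ∀ x y → x ++ y ∈ T → x ∈ T

  ChildOnPath : Trie X → List X → List X → Set
  ChildOnPath T v x = ∃[ q ] ∃[ a ] ∃[ r ] (x ≡ q ++ [ a ] × q ∈ T × v ≡ (q ++ [ a ]) ++ r)

  isNode? : (x : List X) (T : Trie X) → Dec (x ∈ T)
  isNode? = DecMembership._∈?_ (≡-dec _≟X_)

  insertFrom-⊇ : ∀ T pre w {x} → x ∈ T → x ∈ insertFrom T pre w
  insertFrom-⊇ T pre [] x∈T = x∈T
  insertFrom-⊇ T pre (a ∷ w) x∈T with isNode? (pre ++ [ a ]) T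
  ... | yes _ = insertFrom-⊇ T (pre ++ [ a ]) w x∈T
  ... | no _ = there x∈T

  insertFrom-new : ∀ T pre w {x} → pre ∈ T → x ∈ insertFrom T pre w →
                   x ∈ T ⊎ ChildOnPath T (pre ++ w) x
  insertFrom-new T pre [] _ x∈ = inj₁ x∈
  insertFrom-new T pre (a ∷ w) {x} pre∈T x∈ with isNode? (pre ++ [ a ]) T
  ... | yes pa∈T = map₂ (subst (λ v → ChildOnPath T v x) (++-assoc pre [ a ] w))
                        (insertFrom-new T (pre ++ [ a ]) w pa∈T x∈)
  ... | no _ with x∈
  ...   | here refl = inj₂ (pre , a , w , refl , pre∈T , sym (++-assoc pre [ a ] w))
  ...   | there x∈T = inj₁ x∈T

  insertFrom-reaches : ∀ T → PrefixClosed T → ∀ pre u c r → pre ++ u ∈ T →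
                       (pre ++ u) ++ [ c ] ∈ insertFrom T pre (u ++ c ∷ r)
  insertFrom-reaches T pc pre [] c r _ rewrite ++-identityʳ pre with isNode? (pre ++ [ c ]) T
  ... | yes pc∈T = insertFrom-⊇ T (pre ++ [ c ]) r pc∈T
  ... | no _ = here refl
  insertFrom-reaches T pc pre (a ∷ u) c r pau∈T with isNode? (pre ++ [ a ]) T
  ... | yes _ = subst (λ v → v ++ [ c ] ∈ insertFrom T (pre ++ [ a ]) (u ++ c ∷ r))
                      (++-assoc pre [ a ] u)
                      (insertFrom-reaches T pc (pre ++ [ a ]) u c r pa-u∈T)
    where
    pa-u∈T : (pre ++ [ a ]) ++ u ∈ T
    pa-u∈T = subst (_∈ T) (sym (++-assoc pre [ a ] u)) pau∈T
  ... | no pa∉T = ⊥-elim (pa∉T (pc (pre ++ [ a ]) u (subst (_∈ T) (sym (++-assoc pre [ a ] u)) pau∈T)))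

  snoc-prefix : ∀ (x y q : List X) a → x ++ y ≡ q ++ [ a ] → y ≡ [] ⊎ ∃[ y' ] x ++ y' ≡ q
  snoc-prefix [] y q a _ = inj₂ (q , refl)
  snoc-prefix (b ∷ x) y [] a e = inj₁ (++-conicalʳ x y (∷-injectiveʳ e))
  snoc-prefix (b ∷ x) y (b' ∷ q) a e with snoc-prefix x y q a (∷-injectiveʳ e)
  ... | inj₁ y≡[] = inj₁ y≡[]
  ... | inj₂ (y' , xy'≡q) = inj₂ (y' , cong₂ _∷_ (∷-injectiveˡ e) xy'≡q)

  -- Insertion keeps a trie a trie, since each new node extends an old one.
  insertFrom-prefixClosed : ∀ T pre w → pre ∈ T → PrefixClosed T → PrefixClosed (insertFrom T pre w)
  insertFrom-prefixClosed T pre w pre∈T pc x y xy∈ with insertFrom-new T pre w pre∈T xy∈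
  ... | inj₁ xy∈T = insertFrom-⊇ T pre w (pc x y xy∈T)
  ... | inj₂ (q , a , _ , xy≡qa , q∈T , _) with snoc-prefix x y q a xy≡qa
  ...   | inj₁ refl = subst (_∈ insertFrom T pre w) (++-identityʳ x) xy∈
  ...   | inj₂ (y' , xy'≡q) = insertFrom-⊇ T pre w (pc x y' (subst (_∈ T) (sym xy'≡q) q∈T))

module ShiftClosure {X : Set} (_≟X_ : DecidableEquality X) (σ : List X → List X)
  (σ-[] : σ [] ≡ [])
  (σ-++ : ∀ x y → ∃[ z ] σ (x ++ y) ≡ σ x ++ z)
  (σ-∷ʳ : ∀ x a → σ (x ++ [ a ]) ≡ σ x ⊎ ∃[ b ] σ (x ++ [ a ]) ≡ σ x ++ [ b ])
  where

  open TrieInsertion _≟X_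

  insert : Trie X → List X → Trie X
  insert = shtInsert _≟X_

  Closed : Trie X → Set
  Closed T = PrefixClosed T × (∀ x → x ∈ T → σ x ∈ T)

  -- Invariant of the construction when w is the next word to be inserted:
  -- the images under σ of the current nodes appear once w is inserted.
  Ready : Trie X → List X → Set
  Ready T w = [] ∈ T × PrefixClosed T × (∀ x → x ∈ T → σ x ∈ insert T w)

  -- A node newly created by inserting w is a child q ++ [ a ] of an old node on
  -- w's path, so its image is σ q or a child of σ q on the path of σ w.
  ready-step : ∀ T w → Ready T w → Ready (insert T w) (σ w)
  ready-step T w ([]∈T , pc , σ∈) = insertFrom-⊇ T [] w []∈T , pc' , σ∈'
    where
    T' : Trie X
    T' = insert T w

    pc' : PrefixClosed T'
    pc' = insertFrom-prefixClosed T [] w []∈T pc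

    old : ∀ {x} → x ∈ T → σ x ∈ insert T' (σ w)
    old x∈T = insertFrom-⊇ T' [] (σ w) (σ∈ _ x∈T)

    child : ∀ q a r → q ∈ T → w ≡ (q ++ [ a ]) ++ r → σ (q ++ [ a ]) ∈ insert T' (σ w)
    child q a r q∈T w≡ with σ-∷ʳ q a | σ-++ (q ++ [ a ]) r
    ... | inj₁ σqa≡σq | _ = subst (_∈ insert T' (σ w)) (sym σqa≡σq) (old q∈T)
    ... | inj₂ (b , σqa≡σqb) | z , σqar≡ = subst (_∈ insert T' (σ w)) (sym σqa≡σqb) reach
      where
      open ≡-Reasoning
      σw≡ : σ w ≡ σ q ++ b ∷ z
      σw≡ = begin
        σ w                        ≡⟨ cong σ w≡ ⟩
        σ ((q ++ [ a ]) ++ r)      ≡⟨ σqar≡ ⟩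
        σ (q ++ [ a ]) ++ z        ≡⟨ cong (_++ z) σqa≡σqb ⟩
        (σ q ++ [ b ]) ++ z        ≡⟨ ++-assoc (σ q) [ b ] z ⟩
        σ q ++ b ∷ z               ∎

      reach : σ q ++ [ b ] ∈ insert T' (σ w)
      reach rewrite σw≡ = insertFrom-reaches T' pc' [] (σ q) b z (σ∈ q q∈T)

    σ∈' : ∀ x → x ∈ T' → σ x ∈ insert T' (σ w)
    σ∈' x x∈ with insertFrom-new T [] w []∈T x∈
    ... | inj₁ x∈T = old x∈T
    ... | inj₂ (q , a , r , refl , q∈T , w≡) = child q a r q∈T w≡

  insertChain-closed : ∀ m (h : ℕ → List X) T → (∀ k → h (suc k) ≡ σ (h k)) → h m ≡ [] →
                       Ready T (h 0) → Closed (foldl insert T (applyUpTo h m))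
  insertChain-closed zero h T _ h0≡[] (_ , pc , σ∈) =
    pc , λ x x∈T → subst (λ w → σ x ∈ insert T w) h0≡[] (σ∈ x x∈T)
  insertChain-closed (suc m) h T hσ hm≡[] ready =
    insertChain-closed m (λ k → h (suc k)) (insert T (h 0)) (λ k → hσ (suc k)) hm≡[]
      (subst (Ready (insert T (h 0))) (sym (hσ 0)) (ready-step T (h 0) ready))

  root-ready : ∀ w → Ready ([] ∷ []) w
  root-ready w = here refl , root-prefixClosed , root-σ
    where
    root-prefixClosed : PrefixClosed ([] ∷ [])
    root-prefixClosed [] _ _ = here refl
    root-prefixClosed (_ ∷ _) _ (here ())

    root-σ : ∀ x → x ∈ [] ∷ [] → σ x ∈ insert ([] ∷ []) w
    root-σ x (here refl) = subst (_∈ insert ([] ∷ []) w) (sym σ-[]) (insertFrom-⊇ _ [] w (here refl))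

  SHT-closed : ∀ m (h : ℕ → List X) → (∀ k → h (suc k) ≡ σ (h k)) → h m ≡ [] →
               Closed (SHT _≟X_ (applyUpTo h m))
  SHT-closed m h hσ hm≡[] = insertChain-closed m h ([] ∷ []) hσ hm≡[] (root-ready (h 0))

module PrevEncoding {S P : Set} (_≟P_ : DecidableEquality P) where

  Enc : Set
  Enc = S ⊎ ℕ

  -- At 0-based position n of the remaining string, the back-distance n + 1
  -- pointed at the removed first symbol; it now marks a first occurrence.
  cut : ℕ → ℕ → ℕ
  cut n d = if d ≡ᵇ suc n then 0 else d

  tailEncFrom : ℕ → List Enc → List Enc
  tailEncFrom n [] = []
  tailEncFrom n (e ∷ x) = map₂ (cut n) e ∷ tailEncFrom (suc n) x

  tailEnc : List Enc → List Enc
  tailEnc [] = []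
  tailEnc (_ ∷ x) = tailEncFrom 0 x

  tailEncFrom-++ : ∀ n x y → tailEncFrom n (x ++ y) ≡ tailEncFrom n x ++ tailEncFrom (length x + n) y
  tailEncFrom-++ n [] y = refl
  tailEncFrom-++ n (e ∷ x) y rewrite tailEncFrom-++ (suc n) x y | +-suc (length x) n = refl

  tailEnc-++ : ∀ x y → ∃[ z ] tailEnc (x ++ y) ≡ tailEnc x ++ z
  tailEnc-++ [] y = tailEnc y , refl
  tailEnc-++ (_ ∷ x) y = _ , tailEncFrom-++ 0 x y

  tailEnc-∷ʳ : ∀ x a → tailEnc (x ++ [ a ]) ≡ tailEnc x ⊎ ∃[ b ] tailEnc (x ++ [ a ]) ≡ tailEnc x ++ [ b ]
  tailEnc-∷ʳ [] a = inj₁ refl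
  tailEnc-∷ʳ (_ ∷ x) a = inj₂ (_ , tailEncFrom-++ 0 x [ a ])

  -- Reading past a symbol that is not an occurrence of p: a positive distance grows by one.
  bump : ℕ → ℕ
  bump zero = zero
  bump (suc d) = suc (suc d)

  cut-bump : ∀ n d → cut (suc n) (bump d) ≡ bump (cut n d)
  cut-bump n zero = refl
  cut-bump n (suc d) with d ≡ᵇ n
  ... | true = refl
  ... | false = refl

  isOccurrence : P → S ⊎ P → Bool
  isOccurrence p (inj₁ _) = false
  isOccurrence p (inj₂ q) = does (q ≟P p)

  backDist-∷ : ∀ p e r → backDist _≟P_ p (e ∷ r) ≡ (if isOccurrence p e then 1 else bump (backDist _≟P_ p r))
  backDist-∷ p (inj₁ c) r with backDist _≟P_ p r
  ... | zero = refl
  ... | suc _ = refl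
  backDist-∷ p (inj₂ q) r with q ≟P p
  ... | yes _ = refl
  ... | no _ with backDist _≟P_ p r
  ...   | zero = refl
  ...   | suc _ = refl

  -- Forgetting the oldest symbol a of the history s ++ [ a ] only affects a
  -- distance pointing exactly at a, i.e. equal to length s + 1.
  backDist-forgetOldest : ∀ p a s → cut (length s) (backDist _≟P_ p (s ++ [ a ])) ≡ backDist _≟P_ p s
  backDist-forgetOldest p a [] rewrite backDist-∷ p a [] with isOccurrence p a
  ... | true = refl
  ... | false = refl
  backDist-forgetOldest p a (e ∷ s) rewrite backDist-∷ p e (s ++ [ a ]) | backDist-∷ p e s with isOccurrence p e
  ... | true = refl
  ... | false = trans (cut-bump (length s) (backDist _≟P_ p (s ++ [ a ]))) (cong bump (backDist-forgetOldest p a s))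

  prevAux-forgetOldest : ∀ a s w → tailEncFrom (length s) (prevAux _≟P_ (s ++ [ a ]) w) ≡ prevAux _≟P_ s w
  prevAux-forgetOldest a s [] = refl
  prevAux-forgetOldest a s (inj₁ c ∷ w) = cong (inj₁ c ∷_) (prevAux-forgetOldest a (inj₁ c ∷ s) w)
  prevAux-forgetOldest a s (inj₂ p ∷ w) =
    cong₂ _∷_ (cong inj₂ (backDist-forgetOldest p a s)) (prevAux-forgetOldest a (inj₂ p ∷ s) w)

  prev-tail : ∀ w → prev _≟P_ (drop 1 w) ≡ tailEnc (prev _≟P_ w)
  prev-tail [] = refl
  prev-tail (inj₁ c ∷ w) = sym (prevAux-forgetOldest (inj₁ c) [] w)
  prev-tail (inj₂ p ∷ w) = sym (prevAux-forgetOldest (inj₂ p) [] w)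

  -- Each symbol is encoded from what precedes it, so prev commutes with prefixes.
  prevAux-take : ∀ (s : PString S P) k w → prevAux _≟P_ s (take k w) ≡ take k (prevAux _≟P_ s w)
  prevAux-take s zero w = refl
  prevAux-take s (suc k) [] = refl
  prevAux-take s (suc k) (inj₁ c ∷ w) = cong (inj₁ c ∷_) (prevAux-take (inj₁ c ∷ s) k w)
  prevAux-take s (suc k) (inj₂ p ∷ w) = cong (inj₂ (backDist _≟P_ p s) ∷_) (prevAux-take (inj₂ p ∷ s) k w)

module PositionHeap {S P : Set} (_≟S_ : DecidableEquality S) (_≟P_ : DecidableEquality P)
                    (t : PString S P) where

  open PrevEncoding {S} _≟P_
  open ShiftClosure (Sum.≡-dec _≟S_ _≟_) tailEnc refl tailEnc-++ tailEnc-∷ʳ using (Closed; SHT-closed)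

  heap : Trie Enc
  heap = PPH _≟S_ _≟P_ t

  -- The suffix encodings prev(t[k+1:]) form a tailEnc-chain ending in ε.
  heap-closed : Closed heap
  heap-closed = subst (λ W → Closed (SHT _ W)) (sym (map-upTo suffixEnc (length t)))
                      (SHT-closed (length t) suffixEnc step (cong (prev _≟P_) (drop-all (length t) t ≤-refl)))
    where
    suffixEnc : ℕ → List Enc
    suffixEnc k = prev _≟P_ (drop k t)

    step : ∀ k → suffixEnc (suc k) ≡ tailEnc (suffixEnc k)
    step k = begin
      prev _≟P_ (drop (1 + k) t)         ≡⟨ cong (λ n → prev _≟P_ (drop n t)) (+-comm 1 k) ⟩
      prev _≟P_ (drop (k + 1) t)         ≡⟨ cong (prev _≟P_) (sym (drop-drop k 1 t)) ⟩
      prev _≟P_ (drop 1 (drop k t))      ≡⟨ prev-tail (drop k t) ⟩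
      tailEnc (prev _≟P_ (drop k t))     ∎
      where open ≡-Reasoning

  prev-drop-closed : ∀ l (v : PString S P) → prev _≟P_ v ∈ heap → prev _≟P_ (drop l v) ∈ heap
  prev-drop-closed zero v v∈ = v∈
  prev-drop-closed (suc l) [] v∈ = v∈
  prev-drop-closed (suc l) (e ∷ v) v∈ =
    prev-drop-closed l v (subst (_∈ heap) (sym (prev-tail (e ∷ v))) (proj₂ heap-closed _ v∈))

  prev-take-closed : ∀ k (v : PString S P) → prev _≟P_ v ∈ heap → prev _≟P_ (take k v) ∈ heap
  prev-take-closed k v v∈ = subst (_∈ heap) (sym (prevAux-take [] k v))
    (proj₁ heap-closed (take k (prev _≟P_ v)) (drop k (prev _≟P_ v))
      (subst (_∈ heap) (sym (take++drop≡id k (prev _≟P_ v))) v∈))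

  prev-factor-closed : ∀ (v : PString S P) l k → prev _≟P_ v ∈ heap → prev _≟P_ (drop l (take k v)) ∈ heap
  prev-factor-closed v l k v∈ = prev-drop-closed l (take k v) (prev-take-closed k v v∈)

substr-factor : ∀ {A : Set} (w : List A) {i i' j' j} → 1 ≤ i → i ≤ i' → i' ≤ j' → j' ≤ j →
                ∃₂ λ l k → substr w i' j' ≡ drop l (take k (substr w i j))
substr-factor {A} w {suc a} {j = j} _ i≤i' i'≤j' j'≤j with m≤n⇒∃[o]m+o≡n i≤i'
... | l , refl with m≤n⇒∃[o]m+o≡n (≤-trans (n≤1+n (a + l)) i'≤j')
...   | r , refl = l , l + r , factor
  where
  open ≡-Reasoning

  u : List A
  u = drop a w

  l+r≤j∸a : l + r ≤ j ∸ a
  l+r≤j∸a = subst (_≤ j ∸ a) (m+n∸m≡n a (l + r)) (∸-monoˡ-≤ a (subst (_≤ j) (+-assoc a l r) j'≤j))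

  factor : take (a + l + r ∸ (a + l)) (drop (a + l) w) ≡ drop l (take (l + r) (take (j ∸ a) u))
  factor = begin
    take (a + l + r ∸ (a + l)) (drop (a + l) w)   ≡⟨ cong (λ m → take m (drop (a + l) w)) (m+n∸m≡n (a + l) r) ⟩
    take r (drop (a + l) w)                       ≡⟨ cong (take r) (sym (drop-drop a l w)) ⟩
    take r (drop l u)                             ≡⟨ take-drop r l u ⟩
    drop l (take (l + r) u)                       ≡⟨ cong (λ k → drop l (take k u)) (sym (m≤n⇒m⊓n≡m l+r≤j∸a)) ⟩
    drop l (take ((l + r) ⊓ (j ∸ a)) u)           ≡⟨ cong (drop l) (sym (take-take (l + r) (j ∸ a) u)) ⟩
    drop l (take (l + r) (take (j ∸ a) u))        ∎

mainTheorem1 : {S P : Set} (_≟S_ : DecidableEquality S) (_≟P_ : DecidableEquality P)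
    (t : PString S P) (i j : ℕ) → 1 ≤ i → i ≤ j → j ≤ length t →
    RepresentedIn (prev _≟P_ (substr t i j)) (PPH _≟S_ _≟P_ t) →
    (i' j' : ℕ) → i ≤ i' → i' ≤ j' → j' ≤ j →
    RepresentedIn (prev _≟P_ (substr t i' j')) (PPH _≟S_ _≟P_ t)
mainTheorem1 _≟S_ _≟P_ t i j 1≤i _ _ represented i' j' i≤i' i'≤j' j'≤j
  with substr-factor t 1≤i i≤i' i'≤j' j'≤j
... | l , k , isFactor =
  subst (λ v → RepresentedIn (prev _≟P_ v) (PPH _≟S_ _≟P_ t)) (sym isFactor)
        (PositionHeap.prev-factor-closed _≟S_ _≟P_ t (substr t i j) l k represented)
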